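{- For an integer $n>1$, let $k=\lceil\log_2 n\rceil$ and define the graph $G^\star$ as follows. Its vertex set consists of $v^{(0)}_j$ for $j\in\{1,\dots,k\}$, $v^{(l)}_i$ for $l\in\{1,2,3\}$ and $i\in\{1,\dots,n-1\}$, and two further vertices $F$ and $E$. Its edges are: $F v^{(0)}_j$ for all $j$; $v^{(0)}_j v^{(1)}_i$ whenever the $j$-th bit of the $k$-bit binary representation of $i$ equals $1$ (bits indexed so that $j=k$ is the least significant bit); $v^{(l)}_i v^{(l+1)}_i$ for $l\in\{1,2\}$ and all $i$; and $v^{(3)}_i E$ for all $i$. Then the set $S^\star=\{v^{(0)}_1,\dots,v^{(0)}_k\}\cup\{F\}$ is a resolving set of $G^\star$, and consequently $\beta(G^\star)\le \lceil \log_2 n\rceil+1$.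
   Context: For a connected graph $G=(V,E)$, a set $R\subseteq V$ is resolving if for every pair of distinct vertices $A\neq B$ there is $X\in R$ with $d_G(A,X)\neq d_G(B,X)$, where $d_G$ is shortest-path distance. The metric dimension $\beta(G)$ is the minimum cardinality of a resolving set. -}

module Defs where

open import Data.Nat using (ℕ; zero; suc; _+_; _∸_; _≤_; _<_)
open import Data.Nat.DivMod using (_/_; _%_)
open import Data.Nat.Logarithm using (⌈log₂_⌉)
open import Data.Fin using (Fin; toℕ)
open import Data.List using (List; length; map; _++_; [_])
open import Data.List.Membership.Propositional using (_∈_)
open import Data.List.Relation.Unary.Unique.Propositional using (Unique)
open import Data.Product using (Σ; ∃; _×_; _,_)
open import Data.Sum using (_⊎_)
open import Relation.Binary.PropositionalEquality using (_≡_; _≢_)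
import Data.List as L

module Graph {V : Set} (Adj : V → V → Set) where

  data Walk : V → V → ℕ → Set where
    nil  : ∀ {A} → Walk A A 0
    cons : ∀ {A B C m} → Adj A B → Walk B C m → Walk A C (suc m)

  Dist : V → V → ℕ → Set
  Dist A B m = Walk A B m × (∀ m' → Walk A B m' → m ≤ m')

  Resolving : List V → Set
  Resolving R = ∀ A B → A ≢ B →
    Σ V λ X → X ∈ R × Σ ℕ λ a → Σ ℕ λ b →
      Dist A X a × Dist B X b × a ≢ b

  IsMetricDim : ℕ → Set
  IsMetricDim b =
    (Σ (List V) λ R → Unique R × Resolving R × length R ≡ b) ×
    (∀ R → Unique R → Resolving R → b ≤ length R)

bit : ℕ → ℕ → ℕ
bit zero    i = i % 2
bit (suc p) i = bit p (i / 2)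

-- The graph G* for parameter n, with k = ⌈log₂ n⌉.
-- v0 j  (j : Fin k)        stands for v^{(0)}_{toℕ j + 1}
-- v1/v2/v3 i (i : Fin (n∸1)) stand for v^{(l)}_{toℕ i + 1}

data Vtx (n : ℕ) : Set where
  v0 : Fin ⌈log₂ n ⌉ → Vtx n
  v1 v2 v3 : Fin (n ∸ 1) → Vtx n
  F E : Vtx n

idx : ∀ {m} → Fin m → ℕ
idx i = suc (toℕ i)

-- the j-th bit (j ∈ {1..k}, j = k least significant) of the k-bit
-- representation of i is bit number (k - j) from the least significant end
data Edge (n : ℕ) : Vtx n → Vtx n → Set where
  F-v0  : ∀ j → Edge n F (v0 j)
  v0-v1 : ∀ j i → bit (⌈log₂ n ⌉ ∸ idx j) (idx i) ≡ 1 → Edge n (v0 j) (v1 i)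
  v1-v2 : ∀ i → Edge n (v1 i) (v2 i)
  v2-v3 : ∀ i → Edge n (v2 i) (v3 i)
  v3-E  : ∀ i → Edge n (v3 i) E

Adj⋆ : (n : ℕ) → Vtx n → Vtx n → Set
Adj⋆ n A B = Edge n A B ⊎ Edge n B A

S⋆ : (n : ℕ) → List (Vtx n)
S⋆ n = map v0 (L.allFin ⌈log₂ n ⌉) ++ [ F ]

{-# OPTIONS --safe #-}
-- A vertex A has distance 0, 1, …, 5 to F according as it is F, some v⁽⁰⁾, v⁽¹⁾, v⁽²⁾,
-- v⁽³⁾ or E, so F separates any two vertices in different layers. Inside a layer
-- v⁽ˡ⁾ (l ≥ 1) the distance from v⁽ˡ⁾ᵢ to v⁽⁰⁾ⱼ is l if bit j of i is set and l + 2
-- otherwise (the detour goes through another v⁽⁰⁾ and F), and distinct i < n ≤ 2ᵏ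
-- differ in some bit. Two distinct v⁽⁰⁾ⱼ are at distance 0 and 2 from one of them.
-- Each distance is certified by a walk of that length together with a potential
-- that changes by at most 1 along every edge and vanishes at the target.
module Submission where

open import Defs
open import Data.Nat using (ℕ; _+_; _≤_; _<_; zero; suc; _∸_; _*_; _^_; z≤n; s≤s; ⌈_/2⌉; _≟_; _<?_)
open import Data.Nat.Properties
open import Data.Nat.DivMod using (_/_; _%_; m≡m%n+[m/n]*n; m%n<n; m*n/n≡m; m<n*o⇒m/o<n)
open import Data.Nat.Logarithm using (⌈log₂_⌉; ⌈log₂⌉-mono-≤; ⌈log₂2^n⌉≡n)
open import Data.Nat.Logarithm.Core using (⌈log2⌉)
open import Data.Nat.Induction using (<-wellFounded)
open import Induction.WellFounded using (Acc; acc)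
open import Data.Fin using (Fin; toℕ; fromℕ<; opposite)
open import Data.Fin.Properties using (toℕ-fromℕ<; opposite-prop; toℕ<n; toℕ-injective)
import Data.Fin.Properties as Fin
open import Data.List using (length; map; _++_; [_]; allFin)
open import Data.List.Properties using (length-++; length-map; length-tabulate)
open import Data.List.Membership.Propositional using (_∈_)
open import Data.List.Membership.Propositional.Properties using (∈-map⁺; ∈-map⁻; ∈-++⁺ˡ; ∈-++⁺ʳ; ∈-allFin)
open import Data.List.Relation.Unary.Any using (here)
open import Data.List.Relation.Unary.Unique.Propositional using (Unique)
open import Data.List.Relation.Unary.Unique.Propositional.Properties using (++⁺; map⁺; allFin⁺)
open import Data.List.Relation.Unary.AllPairs using ([]; _∷_)
import Data.List.Relation.Unary.All as All
open import Data.Product using (Σ; _×_; _,_; proj₁; proj₂)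
open import Data.Sum using (_⊎_; inj₁; inj₂)
open import Relation.Nullary using (¬_; yes; no; contradiction)
open import Relation.Binary.PropositionalEquality hiding ([_])
open import Function using (_∘_)

Close : ℕ → ℕ → Set
Close a b = a ≤ suc b × b ≤ suc a

close-suc : ∀ a → Close a (suc a)
close-suc a = m≤n⇒m≤1+n (n≤1+n a) , ≤-refl

close-sym : ∀ {a b} → Close a b → Close b a
close-sym (a≤ , b≤) = b≤ , a≤

module _ {V : Set} (Adj : V → V → Set) where
  open Graph Adj

  OneLipschitz : (V → ℕ) → Set
  OneLipschitz f = ∀ {A B} → Adj A B → f A ≤ suc (f B)

  walk-length-≥ : ∀ {f} → OneLipschitz f → ∀ {A B m} → Walk A B m → f A ≤ f B + m
  walk-length-≥ lip nil = ≤-reflexive (sym (+-identityʳ _))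
  walk-length-≥ {f} lip {B = B} (cons {m = m} a w) = begin
    f _             ≤⟨ lip a ⟩
    suc (f _)       ≤⟨ s≤s (walk-length-≥ lip w) ⟩
    suc (f B + m)   ≡⟨ +-suc (f B) m ⟨
    f B + suc m     ∎
    where open ≤-Reasoning

  dist-from-potential : ∀ {f X} → OneLipschitz f → f X ≡ 0 →
                        ∀ {A} → Walk A X (f A) → Dist A X (f A)
  dist-from-potential {f} lip fX≡0 {A} w =
    w , λ m w′ → subst (λ x → f A ≤ x + m) fX≡0 (walk-length-≥ lip w′)

lipschitz-symmetric-closure : ∀ {V : Set} {R : V → V → Set} {f : V → ℕ} →
  (∀ {A B} → R A B → Close (f A) (f B)) → OneLipschitz (λ A B → R A B ⊎ R B A) f
lipschitz-symmetric-closure close (inj₁ r) = proj₁ (close r)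
lipschitz-symmetric-closure close (inj₂ r) = proj₂ (close r)

bit≤1 : ∀ p x → bit p x ≤ 1
bit≤1 zero    x = ≤-pred (m%n<n x 2)
bit≤1 (suc p) x = bit≤1 p (x / 2)

bit-of-0 : ∀ p → bit p 0 ≡ 0
bit-of-0 zero    = refl
bit-of-0 (suc p) = bit-of-0 p

bit-of-2^ : ∀ p → bit p (2 ^ p) ≡ 1
bit-of-2^ zero    = refl
bit-of-2^ (suc p) = begin
  bit p (2 * 2 ^ p / 2)   ≡⟨ cong (λ x → bit p (x / 2)) (*-comm 2 (2 ^ p)) ⟩
  bit p (2 ^ p * 2 / 2)   ≡⟨ cong (bit p) (m*n/n≡m (2 ^ p) 2) ⟩
  bit p (2 ^ p)           ≡⟨ bit-of-2^ p ⟩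
  1                       ∎
  where open ≡-Reasoning

bits-differ : ∀ k {x y} → x < 2 ^ k → y < 2 ^ k → x ≢ y →
              Σ ℕ λ p → p < k × bit p x ≢ bit p y
bits-differ zero    {zero} {zero} _ _ x≢y = contradiction refl x≢y
bits-differ zero    {suc _} (s≤s ()) _ _
bits-differ zero    {y = suc _} _ (s≤s ()) _
bits-differ (suc k) {x} {y} x< y< x≢y with x % 2 ≟ y % 2
... | no lsb≢ = 0 , s≤s z≤n , lsb≢
... | yes lsb≡ =
  let p , p<k , differ = bits-differ k (halve x<) (halve y<) halves≢ in suc p , s≤s p<k , differ
  where
  halve : ∀ {z} → z < 2 ^ suc k → z / 2 < 2 ^ k
  halve {z} z< = m<n*o⇒m/o<n (subst (z <_) (*-comm 2 (2 ^ k)) z<)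
  halves≢ : x / 2 ≢ y / 2
  halves≢ eq = x≢y (begin
    x                   ≡⟨ m≡m%n+[m/n]*n x 2 ⟩
    x % 2 + x / 2 * 2   ≡⟨ cong₂ (λ a b → a + b * 2) lsb≡ eq ⟩
    y % 2 + y / 2 * 2   ≡⟨ m≡m%n+[m/n]*n y 2 ⟨
    y                   ∎)
    where open ≡-Reasoning

bit≢0⇒bit≡1 : ∀ p x → bit p x ≢ 0 → bit p x ≡ 1
bit≢0⇒bit≡1 p x bit≢0 with bit p x | bit≤1 p x
... | zero     | _ = contradiction refl bit≢0
... | suc zero | _ = refl
... | suc (suc _) | s≤s ()

positive-has-set-bit : ∀ k {x} → 0 < x → x < 2 ^ k → Σ ℕ λ p → p < k × bit p x ≡ 1
positive-has-set-bit k {x} 0<x x< =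
  let p , p<k , differ = bits-differ k x< (m^n>0 2 k) (λ x≡0 → <-irrefl (sym x≡0) 0<x)
  in p , p<k , bit≢0⇒bit≡1 p x (λ bit≡0 → differ (trans bit≡0 (sym (bit-of-0 p))))

n≤2^⌈log2⌉n : ∀ n (rec : Acc _<_ n) → n ≤ 2 ^ ⌈log2⌉ n rec
n≤2^⌈log2⌉n zero          _        = z≤n
n≤2^⌈log2⌉n (suc zero)    _        = s≤s z≤n
n≤2^⌈log2⌉n (suc (suc m)) (acc rs) = begin
  2 + m               ≤⟨ s≤s (s≤s m≤2h) ⟩
  2 + (h + h)         ≡⟨ cong suc (+-suc h h) ⟨
  suc h + suc h       ≡⟨ cong (suc h +_) (+-identityʳ (suc h)) ⟨
  2 * suc h           ≤⟨ *-monoʳ-≤ 2 (n≤2^⌈log2⌉n (suc h) (rs (⌈n/2⌉<n m))) ⟩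
  2 ^ ⌈log2⌉ (2 + m) (acc rs) ∎
  where
  open ≤-Reasoning
  h = ⌈ m /2⌉
  m≤2h : m ≤ h + h
  m≤2h = ≤-trans (≤-reflexive (sym (⌊n/2⌋+⌈n/2⌉≡n m))) (+-monoˡ-≤ h (⌊n/2⌋≤⌈n/2⌉ m))

n≤2^⌈log₂n⌉ : ∀ n → n ≤ 2 ^ ⌈log₂ n ⌉
n≤2^⌈log₂n⌉ n = n≤2^⌈log2⌉n n (<-wellFounded n)

1≤⌈log₂n⌉ : ∀ {n} → 1 < n → 1 ≤ ⌈log₂ n ⌉
1≤⌈log₂n⌉ {n} 1<n = subst (_≤ ⌈log₂ n ⌉) (⌈log₂2^n⌉≡n 1) (⌈log₂⌉-mono-≤ 1<n)

2^[⌈log₂n⌉∸1]<n : ∀ {n} → 1 < n → 2 ^ (⌈log₂ n ⌉ ∸ 1) < n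
2^[⌈log₂n⌉∸1]<n {n} 1<n with 2 ^ (⌈log₂ n ⌉ ∸ 1) <? n
... | yes < = <
... | no ≮ = contradiction k≤k∸1 (k≰k∸1 (1≤⌈log₂n⌉ 1<n))
  where
  k≤k∸1 : ⌈log₂ n ⌉ ≤ ⌈log₂ n ⌉ ∸ 1
  k≤k∸1 = subst (⌈log₂ n ⌉ ≤_) (⌈log₂2^n⌉≡n _) (⌈log₂⌉-mono-≤ (≮⇒≥ ≮))
  k≰k∸1 : ∀ {k} → 1 ≤ k → ¬ k ≤ k ∸ 1
  k≰k∸1 {suc k} _ = 1+n≰n

module G⋆ (n : ℕ) (1<n : 1 < n) where
  open Graph (Adj⋆ n)

  k : ℕ
  k = ⌈log₂ n ⌉

  Index : Set
  Index = Fin (n ∸ 1)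

  idx<2^k : (i : Index) → idx i < 2 ^ k
  idx<2^k i = begin-strict
    suc (toℕ i)   <⟨ s≤s (toℕ<n i) ⟩
    suc (n ∸ 1)   ≡⟨ m+[n∸m]≡n (<⇒≤ 1<n) ⟩
    n             ≤⟨ n≤2^⌈log₂n⌉ n ⟩
    2 ^ k         ∎
    where open ≤-Reasoning

  index-of : ∀ {x} → 0 < x → x < n → Σ Index λ i → idx i ≡ x
  index-of {suc x} _ x<n = fromℕ< x<n∸1 , cong suc (toℕ-fromℕ< x<n∸1)
    where
    x<n∸1 : x < n ∸ 1
    x<n∸1 = ∸-monoˡ-≤ 1 x<n

  position-of : ∀ {p} → p < k → Σ (Fin k) λ j → k ∸ idx j ≡ p
  position-of {p} p<k = j , (begin
    k ∸ suc (toℕ j)          ≡⟨ cong (λ t → k ∸ suc t) (opposite-prop (fromℕ< p<k)) ⟩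
    k ∸ suc (k ∸ suc (toℕ (fromℕ< p<k))) ≡⟨ cong (λ t → k ∸ suc (k ∸ suc t)) (toℕ-fromℕ< p<k) ⟩
    k ∸ suc (k ∸ suc p)      ≡⟨ cong (k ∸_) (+-∸-assoc 1 p<k) ⟨
    k ∸ (k ∸ p)              ≡⟨ m∸[m∸n]≡n (<⇒≤ p<k) ⟩
    p                        ∎)
    where
    open ≡-Reasoning
    j = opposite (fromℕ< p<k)

  digit : Fin k → Index → ℕ
  digit j i = bit (k ∸ idx j) (idx i)

  digit≤1 : ∀ j i → digit j i ≤ 1
  digit≤1 j i = bit≤1 (k ∸ idx j) (idx i)

  some-digit-set : (i : Index) → Σ (Fin k) λ j → digit j i ≡ 1
  some-digit-set i with positive-has-set-bit k (s≤s z≤n) (idx<2^k i)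
  ... | p , p<k , set with position-of p<k
  ...   | j , refl = j , set

  digits-separate : {i i′ : Index} → i ≢ i′ → Σ (Fin k) λ j → digit j i ≢ digit j i′
  digits-separate {i} {i′} i≢i′
    with bits-differ k (idx<2^k i) (idx<2^k i′) (λ eq → i≢i′ (toℕ-injective (suc-injective eq)))
  ... | p , p<k , differ with position-of p<k
  ...   | j , refl = j , differ

  digit-set-somewhere : (j : Fin k) → Σ Index λ i → digit j i ≡ 1
  digit-set-somewhere j =
    let i , idx≡ = index-of (m^n>0 2 p) 2^p<n in i , trans (cong (bit p) idx≡) (bit-of-2^ p)
    where
    p = k ∸ idx j
    2^p<n : 2 ^ p < n
    2^p<n = ≤-<-trans (^-monoʳ-≤ 2 (∸-monoʳ-≤ k (s≤s z≤n))) (2^[⌈log₂n⌉∸1]<n 1<n)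

  dist-to : ∀ {X} (f : Vtx n → ℕ) → (∀ {A B} → Edge n A B → Close (f A) (f B)) →
            f X ≡ 0 → (∀ A → Walk A X (f A)) → ∀ A → Dist A X (f A)
  dist-to f close fX≡0 walk A =
    dist-from-potential (Adj⋆ n) (lipschitz-symmetric-closure {R = Edge n} close) fX≡0 (walk A)

  v1⇝F : ∀ i → Walk (v1 i) F 2
  v1⇝F i = let j , set = some-digit-set i in cons (inj₂ (v0-v1 j i set)) (cons (inj₂ (F-v0 j)) nil)

  dF : Vtx n → ℕ
  dF F      = 0
  dF (v0 _) = 1
  dF (v1 _) = 2
  dF (v2 _) = 3
  dF (v3 _) = 4
  dF E      = 5

  dF-close : ∀ {A B} → Edge n A B → Close (dF A) (dF B)
  dF-close (F-v0 _)      = close-suc 0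
  dF-close (v0-v1 _ _ _) = close-suc 1
  dF-close (v1-v2 _)     = close-suc 2
  dF-close (v2-v3 _)     = close-suc 3
  dF-close (v3-E _)      = close-suc 4

  walk-to-F : ∀ A → Walk A F (dF A)
  walk-to-F F      = nil
  walk-to-F (v0 j) = cons (inj₂ (F-v0 j)) nil
  walk-to-F (v1 i) = v1⇝F i
  walk-to-F (v2 i) = cons (inj₂ (v1-v2 i)) (v1⇝F i)
  walk-to-F (v3 i) = cons (inj₂ (v2-v3 i)) (cons (inj₂ (v1-v2 i)) (v1⇝F i))
  walk-to-F E      = cons (inj₂ (v3-E i)) (walk-to-F (v3 i))
    where i = proj₁ (index-of (s≤s z≤n) 1<n)

  dist-to-F : ∀ A → Dist A F (dF A)
  dist-to-F = dist-to dF dF-close refl walk-to-F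

  d₁ : ℕ → ℕ
  d₁ (suc zero) = 1
  d₁ _          = 3

  d₁-injective : ∀ {x y} → x ≤ 1 → y ≤ 1 → d₁ x ≡ d₁ y → x ≡ y
  d₁-injective {suc (suc _)} (s≤s ()) _ _
  d₁-injective {y = suc (suc _)} _ (s≤s ()) _
  d₁-injective {zero}     {zero}     _ _ _  = refl
  d₁-injective {suc zero} {suc zero} _ _ _  = refl
  d₁-injective {zero}     {suc zero} _ _ ()
  d₁-injective {suc zero} {zero}     _ _ ()

  close-2-d₁ : ∀ x → Close 2 (d₁ x)
  close-2-d₁ zero          = s≤s (s≤s z≤n) , s≤s (s≤s (s≤s z≤n))
  close-2-d₁ (suc zero)    = s≤s (s≤s z≤n) , s≤s z≤n
  close-2-d₁ (suc (suc _)) = s≤s (s≤s z≤n) , s≤s (s≤s (s≤s z≤n))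

  d₀ : Fin k → Fin k → ℕ
  d₀ j j′ with j Fin.≟ j′
  ... | yes _ = 0
  ... | no  _ = 2

  d₀-self : ∀ j → d₀ j j ≡ 0
  d₀-self j with j Fin.≟ j
  ... | yes _  = refl
  ... | no j≢j = contradiction refl j≢j

  d₀-other : ∀ {j j′} → j ≢ j′ → d₀ j j′ ≡ 2
  d₀-other {j} {j′} j≢j′ with j Fin.≟ j′
  ... | yes j≡j′ = contradiction j≡j′ j≢j′
  ... | no  _    = refl

  dv : Fin k → Vtx n → ℕ
  dv j F       = 1
  dv j (v0 j′) = d₀ j j′
  dv j (v1 i)  = d₁ (digit j i)
  dv j (v2 i)  = 1 + d₁ (digit j i)
  dv j (v3 i)  = 2 + d₁ (digit j i)
  dv j E       = 4

  dv-close : ∀ j {A B} → Edge n A B → Close (dv j A) (dv j B)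
  dv-close j (F-v0 j′) with j Fin.≟ j′
  ... | yes _ = close-sym (close-suc 0)
  ... | no  _ = close-suc 1
  dv-close j (v0-v1 j′ i set) with j Fin.≟ j′
  ... | yes refl rewrite set = close-suc 0
  ... | no  _ = close-2-d₁ (digit j i)
  dv-close j (v1-v2 i) = close-suc _
  dv-close j (v2-v3 i) = close-suc _
  dv-close j (v3-E i)  = s≤s (s≤s (close-2-d₁ (digit j i) .proj₂)) ,
                         s≤s (s≤s (close-2-d₁ (digit j i) .proj₁))

  v1⇝F⇝v0 : ∀ i j → Walk (v1 i) (v0 j) 3
  v1⇝F⇝v0 i j =
    let j′ , set = some-digit-set i
    in cons (inj₂ (v0-v1 j′ i set)) (cons (inj₂ (F-v0 j′)) (cons (inj₁ (F-v0 j)) nil))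

  v1⇝v0 : ∀ j i → Walk (v1 i) (v0 j) (d₁ (digit j i))
  v1⇝v0 j i with digit j i in set
  ... | suc zero    = cons (inj₂ (v0-v1 j i set)) nil
  ... | zero        = v1⇝F⇝v0 i j
  ... | suc (suc _) = v1⇝F⇝v0 i j

  walk-to-v0 : ∀ j A → Walk A (v0 j) (dv j A)
  walk-to-v0 j F = cons (inj₁ (F-v0 j)) nil
  walk-to-v0 j (v0 j′) with j Fin.≟ j′
  ... | yes refl = nil
  ... | no  _    = cons (inj₂ (F-v0 j′)) (cons (inj₁ (F-v0 j)) nil)
  walk-to-v0 j (v1 i) = v1⇝v0 j i
  walk-to-v0 j (v2 i) = cons (inj₂ (v1-v2 i)) (v1⇝v0 j i)
  walk-to-v0 j (v3 i) = cons (inj₂ (v2-v3 i)) (walk-to-v0 j (v2 i))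
  walk-to-v0 j E =
    let i , set = digit-set-somewhere j
    in cons (inj₂ (v3-E i)) (cons (inj₂ (v2-v3 i)) (cons (inj₂ (v1-v2 i)) (cons (inj₂ (v0-v1 j i set)) nil)))

  dist-to-v0 : ∀ j A → Dist A (v0 j) (dv j A)
  dist-to-v0 j = dist-to (dv j) (dv-close j) (d₀-self j) (walk-to-v0 j)

  Resolved : Vtx n → Vtx n → Set
  Resolved A B = Σ (Vtx n) λ X → X ∈ S⋆ n × Σ ℕ λ a → Σ ℕ λ b →
                 Dist A X a × Dist B X b × a ≢ b

  resolved-by-F : ∀ {A B} → dF A ≢ dF B → Resolved A B
  resolved-by-F {A} {B} d = F , ∈-++⁺ʳ (map v0 (allFin k)) (here refl) ,
                            dF A , dF B , dist-to-F A , dist-to-F B , d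

  resolved-by-v0 : ∀ j {A B} → dv j A ≢ dv j B → Resolved A B
  resolved-by-v0 j {A} {B} d = v0 j , ∈-++⁺ˡ (∈-map⁺ v0 (∈-allFin j)) ,
                               dv j A , dv j B , dist-to-v0 j A , dist-to-v0 j B , d

  digits-resolve : ∀ {i i′} → i ≢ i′ → Σ (Fin k) λ j → d₁ (digit j i) ≢ d₁ (digit j i′)
  digits-resolve {i} {i′} i≢i′ =
    let j , differ = digits-separate i≢i′
    in j , λ eq → differ (d₁-injective (digit≤1 j i) (digit≤1 j i′) eq)

  resolve-within-layer : ∀ A B → dF A ≡ dF B → A ≢ B → Resolved A B
  resolve-within-layer F F _ A≢B = contradiction refl A≢B
  resolve-within-layer E E _ A≢B = contradiction refl A≢B
  resolve-within-layer (v0 j) (v0 j′) _ A≢B =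
    resolved-by-v0 j λ eq → 0≢2 (trans (sym (d₀-self j)) (trans eq (d₀-other (A≢B ∘ cong v0))))
    where
    0≢2 : 0 ≢ 2
    0≢2 ()
  resolve-within-layer (v1 i) (v1 i′) _ A≢B =
    let j , differ = digits-resolve (A≢B ∘ cong v1) in resolved-by-v0 j differ
  resolve-within-layer (v2 i) (v2 i′) _ A≢B =
    let j , differ = digits-resolve (A≢B ∘ cong v2) in resolved-by-v0 j (differ ∘ +-cancelˡ-≡ 1 _ _)
  resolve-within-layer (v3 i) (v3 i′) _ A≢B =
    let j , differ = digits-resolve (A≢B ∘ cong v3) in resolved-by-v0 j (differ ∘ +-cancelˡ-≡ 2 _ _)
  resolve-within-layer F (v0 _) () _
  resolve-within-layer F (v1 _) () _
  resolve-within-layer F (v2 _) () _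
  resolve-within-layer F (v3 _) () _
  resolve-within-layer F E () _
  resolve-within-layer (v0 _) F () _
  resolve-within-layer (v0 _) (v1 _) () _
  resolve-within-layer (v0 _) (v2 _) () _
  resolve-within-layer (v0 _) (v3 _) () _
  resolve-within-layer (v0 _) E () _
  resolve-within-layer (v1 _) F () _
  resolve-within-layer (v1 _) (v0 _) () _
  resolve-within-layer (v1 _) (v2 _) () _
  resolve-within-layer (v1 _) (v3 _) () _
  resolve-within-layer (v1 _) E () _
  resolve-within-layer (v2 _) F () _
  resolve-within-layer (v2 _) (v0 _) () _
  resolve-within-layer (v2 _) (v1 _) () _
  resolve-within-layer (v2 _) (v3 _) () _
  resolve-within-layer (v2 _) E () _
  resolve-within-layer (v3 _) F () _
  resolve-within-layer (v3 _) (v0 _) () _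
  resolve-within-layer (v3 _) (v1 _) () _
  resolve-within-layer (v3 _) (v2 _) () _
  resolve-within-layer (v3 _) E () _
  resolve-within-layer E F () _
  resolve-within-layer E (v0 _) () _
  resolve-within-layer E (v1 _) () _
  resolve-within-layer E (v2 _) () _
  resolve-within-layer E (v3 _) () _

  resolving : Resolving (S⋆ n)
  resolving A B A≢B with dF A ≟ dF B
  ... | yes same = resolve-within-layer A B same A≢B
  ... | no  differ = resolved-by-F differ

  S⋆-unique : Unique (S⋆ n)
  S⋆-unique = ++⁺ (map⁺ v0-injective (allFin⁺ k)) (All.[] ∷ []) disjoint
    where
    v0-injective : ∀ {j j′} → v0 {n} j ≡ v0 j′ → j ≡ j′
    v0-injective refl = refl
    disjoint : ∀ {A} → ¬ (A ∈ map v0 (allFin k) × A ∈ [ F ])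
    disjoint (A∈ , here refl) with ∈-map⁻ v0 A∈
    ... | _ , _ , ()

  length-S⋆ : length (S⋆ n) ≡ k + 1
  length-S⋆ = begin
    length (v0s ++ [ F ])   ≡⟨ length-++ v0s ⟩
    length v0s + 1          ≡⟨ cong (_+ 1) (length-map (v0 {n}) (allFin k)) ⟩
    length (allFin k) + 1   ≡⟨ cong (_+ 1) (length-tabulate {n = k} (λ j → j)) ⟩
    k + 1                   ∎
    where
    open ≡-Reasoning
    v0s = map (v0 {n}) (allFin k)

claim4 : (n : ℕ) → 1 < n →
    Graph.Resolving (Adj⋆ n) (S⋆ n) ×
    (∀ b → Graph.IsMetricDim (Adj⋆ n) b → b ≤ ⌈log₂ n ⌉ + 1)
claim4 n 1<n = resolving , λ b (_ , minimal) →
  ≤-trans (minimal (S⋆ n) S⋆-unique resolving) (≤-reflexive length-S⋆)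
  where open G⋆ n 1<n
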